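{- Let $H=(X,(s_i)_{i\in I})$ be a hypergraph with correspondence $\tau:X\to I$, and let $f:X\to\{0,1,2\}$ be such that $\tau(x)\ne\tau(y)$ for all distinct $x,y\in f^{ -1}(1)$. Then there exists a minimal Roman hitting function $g$ with $f\le g$ if and only if there exist a set $R_2$ with $f^{ -1}(2)\subseteq R_2\subseteq f^{ -1}(1)\cup f^{ -1}(2)$ and a map $\rho:R_2\to I$ such that: (1) for all $x\in R_2$, $\rho(x)\ne\tau(x)$; (2) for all $x\in R_2$, $s_{\rho(x)}\cap R_2=\{x\}$; (3) for all $x\in f^{ -1}(1)\setminus R_2$, $s_{\tau(x)}\cap R_2=\emptyset$; (4) for every $i\in I$ with $\tau^{ -1}(i)=\emptyset$: if $s_i\subseteq\big(\bigcup_{x\in f^{ -1}(1)\setminus R_2}s_{\tau(x)}\big)\cup\big(\bigcup_{x\in R_2}s_{\rho(x)}\big)$, then $s_i\cap R_2\ne\emptyset$.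
   Context: A hypergraph is $H=(X,(s_i)_{i\in I})$ with finite $X$, finite index set $I$, $s_i\subseteq X$ (repetitions allowed). A correspondence is a map $\tau:X\to I$ with $x\in s_{\tau(x)}$ for all $x$. A function $g:X\to\{0,1,2\}$ is a Roman hitting function (rhf) if for every $i\in I$ there is $x\in s_i$ with $g(x)=2$ or there is $x$ with $\tau(x)=i$ and $g(x)=1$. Functions are ordered pointwise; an rhf $g$ is minimal if every rhf $h\le g$ equals $g$. -}

module Defs where

open import Data.Nat using (ℕ)
open import Data.Fin using (Fin)
open import Data.Fin.Subset using (Subset; _∈_)
open import Data.Product using (∃; _×_)
open import Data.Sum using (_⊎_)
open import Relation.Binary.PropositionalEquality using (_≡_)

data Val : Set where
  v0 v1 v2 : Val

data _≤ᵛ_ : Val → Val → Set where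
  0≤0 : v0 ≤ᵛ v0
  0≤1 : v0 ≤ᵛ v1
  0≤2 : v0 ≤ᵛ v2
  1≤1 : v1 ≤ᵛ v1
  1≤2 : v1 ≤ᵛ v2
  2≤2 : v2 ≤ᵛ v2

_≤ᶠ_ : {n : ℕ} → (Fin n → Val) → (Fin n → Val) → Set
f ≤ᶠ g = ∀ x → f x ≤ᵛ g x

-- Hypergraph on X = Fin n with edges s : Fin m → Subset n (I = Fin m).
-- A correspondence τ : X → I satisfies x ∈ s (τ x) for all x.
IsCorrespondence : {n m : ℕ} → (Fin m → Subset n) → (Fin n → Fin m) → Set
IsCorrespondence s τ = ∀ x → x ∈ s (τ x)

IsRHF : {n m : ℕ} → (Fin m → Subset n) → (Fin n → Fin m) → (Fin n → Val) → Set
IsRHF s τ g = ∀ i → (∃ λ x → x ∈ s i × g x ≡ v2) ⊎ (∃ λ x → τ x ≡ i × g x ≡ v1)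

IsMinimalRHF : {n m : ℕ} → (Fin m → Subset n) → (Fin n → Fin m) → (Fin n → Val) → Set
IsMinimalRHF s τ g = IsRHF s τ g × (∀ h → h ≤ᶠ g → IsRHF s τ h → ∀ x → h x ≡ g x)

-- In a minimal Roman hitting function g, lowering a value 2 at x to 1 must leave some edge ρ(x)
-- unhit, so x is the only 2 on s_ρ(x) and ρ(x) ≠ τ(x); lowering a value 1 at x to 0 must leave
-- τ(x) unhit, so s_τ(x) contains no 2.  With R₂ the points where g = 2 and f ≠ 0 this gives the
-- certificate.  Conversely, a certificate determines an explicit Roman hitting function g₀ on
-- which no point other than x can hit ρ(x) (for x ∈ R₂) or τ(x) (for x ∈ f⁻¹(1) ∖ R₂, using
-- the injectivity of τ on f⁻¹(1)).  Hence every Roman hitting function below g₀ still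
-- dominates f, in particular a minimal one, which exists by weight descent.
module Submission where

open import Defs
open import Data.Bool.Properties using (T-≡)
open import Data.Empty using (⊥-elim)
open import Data.Fin using (Fin; zero; suc; _≟_)
open import Data.Fin.Properties using (any?; all?; ¬∀⟶∃¬)
open import Data.Fin.Subset using (Subset; _∈_; _∉_; _∩_; ⁅_⁆; Empty; Nonempty)
open import Data.Fin.Subset.Properties using (_∈?_; nonempty?; x∈⁅x⁆; x∈⁅y⁆⇒x≡y; ⊆-antisym; x∈p∩q⁺; x∈p∩q⁻)
open import Data.Nat using (ℕ; zero; suc; _+_; _≤_; _<_; z≤n; s≤s)
open import Data.Nat.Induction using (<-wellFounded)
open import Data.Nat.Properties using (≤-refl; +-mono-≤; +-mono-<-≤; +-mono-≤-<)
open import Data.Product using (∃; ∃₂; Σ; _×_; _,_; proj₁; proj₂)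
open import Data.Sum using (_⊎_; inj₁; inj₂)
open import Data.Vec using (tabulate)
open import Data.Vec.Functional using (updateAt)
open import Data.Vec.Functional.Properties using (updateAt-updates; updateAt-minimal)
open import Data.Vec.Properties using (lookup∘tabulate; lookup⇒[]=; []=⇒lookup)
open import Data.Vec.Properties.WithK using ([]=-irrelevant)
open import Function using (_∘_; const)
open import Function.Bundles using (_⇔_; mk⇔; Equivalence)
open import Induction.WellFounded using (Acc; acc)
open import Relation.Nullary using (Dec; yes; no; ¬_)
open import Relation.Nullary.Decidable using (isYes; map′; _×-dec_; _⊎-dec_; ¬?; toWitness; fromWitness; decidable-stable)
open import Level using (0ℓ)
open import Relation.Unary using (Pred; Decidable)
open import Relation.Binary.PropositionalEquality using (_≡_; _≢_; refl; sym; trans; subst; cong)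

data _<ᵛ_ : Val → Val → Set where
  0<1 : v0 <ᵛ v1
  0<2 : v0 <ᵛ v2
  1<2 : v1 <ᵛ v2

_≟ᵛ_ : (a b : Val) → Dec (a ≡ b)
v0 ≟ᵛ v0 = yes refl
v0 ≟ᵛ v1 = no λ ()
v0 ≟ᵛ v2 = no λ ()
v1 ≟ᵛ v0 = no λ ()
v1 ≟ᵛ v1 = yes refl
v1 ≟ᵛ v2 = no λ ()
v2 ≟ᵛ v0 = no λ ()
v2 ≟ᵛ v1 = no λ ()
v2 ≟ᵛ v2 = yes refl

≤ᵛ-refl : ∀ a → a ≤ᵛ a
≤ᵛ-refl v0 = 0≤0
≤ᵛ-refl v1 = 1≤1
≤ᵛ-refl v2 = 2≤2

≤ᵛ-trans : ∀ {a b c} → a ≤ᵛ b → b ≤ᵛ c → a ≤ᵛ c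
≤ᵛ-trans 0≤0 q   = q
≤ᵛ-trans 0≤1 1≤1 = 0≤1
≤ᵛ-trans 0≤1 1≤2 = 0≤2
≤ᵛ-trans 0≤2 2≤2 = 0≤2
≤ᵛ-trans 1≤1 q   = q
≤ᵛ-trans 1≤2 2≤2 = 1≤2
≤ᵛ-trans 2≤2 q   = q

v0≤ᵛ : ∀ a → v0 ≤ᵛ a
v0≤ᵛ v0 = 0≤0
v0≤ᵛ v1 = 0≤1
v0≤ᵛ v2 = 0≤2

≤ᵛv2 : ∀ a → a ≤ᵛ v2
≤ᵛv2 v0 = 0≤2
≤ᵛv2 v1 = 1≤2
≤ᵛv2 v2 = 2≤2

<ᵛ⇒≤ᵛ : ∀ {a b} → a <ᵛ b → a ≤ᵛ b
<ᵛ⇒≤ᵛ 0<1 = 0≤1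
<ᵛ⇒≤ᵛ 0<2 = 0≤2
<ᵛ⇒≤ᵛ 1<2 = 1≤2

<ᵛ⇒≢ : ∀ {a b} → a <ᵛ b → a ≢ b
<ᵛ⇒≢ 0<1 ()
<ᵛ⇒≢ 0<2 ()
<ᵛ⇒≢ 1<2 ()

≤ᵛ⇒<ᵛ⊎≡ : ∀ {a b} → a ≤ᵛ b → a <ᵛ b ⊎ a ≡ b
≤ᵛ⇒<ᵛ⊎≡ 0≤0 = inj₂ refl
≤ᵛ⇒<ᵛ⊎≡ 0≤1 = inj₁ 0<1
≤ᵛ⇒<ᵛ⊎≡ 0≤2 = inj₁ 0<2
≤ᵛ⇒<ᵛ⊎≡ 1≤1 = inj₂ refl
≤ᵛ⇒<ᵛ⊎≡ 1≤2 = inj₁ 1<2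
≤ᵛ⇒<ᵛ⊎≡ 2≤2 = inj₂ refl

≡v2-≤ᵛ : ∀ {a b} → a ≡ v2 → a ≤ᵛ b → b ≡ v2
≡v2-≤ᵛ refl 2≤2 = refl

≡v1-≤ᵛ : ∀ {a b} → a ≡ v1 → a ≤ᵛ b → b ≡ v1 ⊎ b ≡ v2
≡v1-≤ᵛ refl 1≤1 = inj₁ refl
≡v1-≤ᵛ refl 1≤2 = inj₂ refl

v1≢v2 : v1 ≢ v2
v1≢v2 ()

∃<ᵛ? : {P : Val → Set} → ∀ b → (∀ a → Dec (P a)) → Dec (∃ λ a → a <ᵛ b × P a)
∃<ᵛ? v0 P? = no λ { (_ , () , _) }
∃<ᵛ? v1 P? = map′ (λ p → v0 , 0<1 , p) (λ { (v0 , 0<1 , p) → p }) (P? v0)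
∃<ᵛ? v2 P? = map′ (λ { (inj₁ p) → v0 , 0<2 , p ; (inj₂ p) → v1 , 1<2 , p })
                   (λ { (v0 , 0<2 , p) → inj₁ p ; (v1 , 1<2 , p) → inj₂ p })
                   (P? v0 ⊎-dec P? v1)

rank : Val → ℕ
rank v0 = 0
rank v1 = 1
rank v2 = 2

rank-mono-≤ : ∀ {a b} → a ≤ᵛ b → rank a ≤ rank b
rank-mono-≤ 0≤0 = z≤n
rank-mono-≤ 0≤1 = z≤n
rank-mono-≤ 0≤2 = z≤n
rank-mono-≤ 1≤1 = ≤-refl
rank-mono-≤ 1≤2 = s≤s z≤n
rank-mono-≤ 2≤2 = ≤-refl

rank-mono-< : ∀ {a b} → a <ᵛ b → rank a < rank b
rank-mono-< 0<1 = s≤s z≤n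
rank-mono-< 0<2 = s≤s z≤n
rank-mono-< 1<2 = s≤s (s≤s z≤n)

module _ {n : ℕ} where

  ≤ᶠ-refl : {g : Fin n → Val} → g ≤ᶠ g
  ≤ᶠ-refl {g} x = ≤ᵛ-refl (g x)

  ≤ᶠ-trans : {g h k : Fin n → Val} → g ≤ᶠ h → h ≤ᶠ k → g ≤ᶠ k
  ≤ᶠ-trans g≤h h≤k x = ≤ᵛ-trans (g≤h x) (h≤k x)

  infixl 30 _[_≔_]
  _[_≔_] : (Fin n → Val) → Fin n → Val → Fin n → Val
  g [ x ≔ a ] = updateAt g x (const a)

  [≔]-≤ᶠ : ∀ {g : Fin n → Val} {x a} → a ≤ᵛ g x → g [ x ≔ a ] ≤ᶠ g
  [≔]-≤ᶠ {g} {x} a≤gx y with y ≟ x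
  ... | yes refl = subst (_≤ᵛ g y) (sym (updateAt-updates y g)) a≤gx
  ... | no y≢x   = subst (_≤ᵛ g y) (sym (updateAt-minimal y x g y≢x)) (≤ᵛ-refl (g y))

  ≤ᶠ-[≔] : ∀ {g h : Fin n → Val} {x} → h ≤ᶠ g → h ≤ᶠ g [ x ≔ h x ]
  ≤ᶠ-[≔] {g} {h} {x} h≤g y with y ≟ x
  ... | yes refl = subst (h y ≤ᵛ_) (sym (updateAt-updates y g)) (≤ᵛ-refl (h y))
  ... | no y≢x   = subst (h y ≤ᵛ_) (sym (updateAt-minimal y x g y≢x)) (h≤g y)

weight : {n : ℕ} → (Fin n → Val) → ℕ
weight {zero}  g = 0
weight {suc n} g = rank (g zero) + weight (g ∘ suc)

weight-mono-≤ : {n : ℕ} {g h : Fin n → Val} → g ≤ᶠ h → weight g ≤ weight h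
weight-mono-≤ {zero}  g≤h = z≤n
weight-mono-≤ {suc n} g≤h = +-mono-≤ (rank-mono-≤ (g≤h zero)) (weight-mono-≤ (g≤h ∘ suc))

weight-mono-< : {n : ℕ} {g h : Fin n → Val} → g ≤ᶠ h → ∀ x → g x <ᵛ h x → weight g < weight h
weight-mono-< {suc n} g≤h zero    gx<hx = +-mono-<-≤ (rank-mono-< gx<hx) (weight-mono-≤ (g≤h ∘ suc))
weight-mono-< {suc n} g≤h (suc x) gx<hx = +-mono-≤-< (rank-mono-≤ (g≤h zero)) (weight-mono-< (g≤h ∘ suc) x gx<hx)

subset : {n : ℕ} {P : Pred (Fin n) 0ℓ} → Decidable P → Subset n
subset P? = tabulate (isYes ∘ P?)

module _ {n : ℕ} {P : Pred (Fin n) 0ℓ} (P? : Decidable P) where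

  ∈-subset⁺ : ∀ {x} → P x → x ∈ subset P?
  ∈-subset⁺ {x} px = lookup⇒[]= x _
    (trans (lookup∘tabulate _ x) (Equivalence.to T-≡ (fromWitness {a? = P? x} px)))

  ∈-subset⁻ : ∀ {x} → x ∈ subset P? → P x
  ∈-subset⁻ {x} x∈ = toWitness {a? = P? x}
    (Equivalence.from T-≡ (trans (sym (lookup∘tabulate _ x)) ([]=⇒lookup x∈)))

module RomanHitting {n m : ℕ} (s : Fin m → Subset n) (τ : Fin n → Fin m) (corr : IsCorrespondence s τ) where

  Hits : (Fin n → Val) → Fin m → Set
  Hits g i = (∃ λ x → x ∈ s i × g x ≡ v2) ⊎ (∃ λ x → τ x ≡ i × g x ≡ v1)

  hits? : ∀ g i → Dec (Hits g i)
  hits? g i = any? (λ x → (x ∈? s i) ×-dec (g x ≟ᵛ v2)) ⊎-dec any? (λ x → (τ x ≟ i) ×-dec (g x ≟ᵛ v1))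

  isRHF? : ∀ g → Dec (IsRHF s τ g)
  isRHF? g = all? (hits? g)

  ∈-τ : ∀ {x i} → τ x ≡ i → x ∈ s i
  ∈-τ {x} refl = corr x

  IsRHF-mono : ∀ {g h} → g ≤ᶠ h → IsRHF s τ g → IsRHF s τ h
  IsRHF-mono {g} {h} g≤h rhf i with rhf i
  ... | inj₁ (x , x∈ , gx≡2) = inj₁ (x , x∈ , ≡v2-≤ᵛ gx≡2 (g≤h x))
  ... | inj₂ (x , τx≡i , gx≡1) with ≡v1-≤ᵛ gx≡1 (g≤h x)
  ...   | inj₁ hx≡1 = inj₂ (x , τx≡i , hx≡1)
  ...   | inj₂ hx≡2 = inj₁ (x , ∈-τ τx≡i , hx≡2)

  Lowerable : (Fin n → Val) → Set
  Lowerable g = ∃₂ λ x a → a <ᵛ g x × IsRHF s τ (g [ x ≔ a ])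

  lowerable? : ∀ g → Dec (Lowerable g)
  lowerable? g = any? λ x → ∃<ᵛ? (g x) (λ a → isRHF? (g [ x ≔ a ]))

  -- By monotonicity, an rhf strictly below g at x can be replaced by g lowered at x alone.
  ¬lowerable⇒minimal : ∀ {g} → IsRHF s τ g → ¬ Lowerable g → IsMinimalRHF s τ g
  ¬lowerable⇒minimal {g} rhf ¬low = rhf , minimal
    where
    minimal : ∀ h → h ≤ᶠ g → IsRHF s τ h → ∀ x → h x ≡ g x
    minimal h h≤g rhfₕ x with ≤ᵛ⇒<ᵛ⊎≡ (h≤g x)
    ... | inj₁ hx<gx = ⊥-elim (¬low (x , h x , hx<gx , IsRHF-mono (≤ᶠ-[≔] h≤g) rhfₕ))
    ... | inj₂ hx≡gx = hx≡gx

  minimal-below : ∀ g → IsRHF s τ g → ∃ λ h → h ≤ᶠ g × IsMinimalRHF s τ h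
  minimal-below g = descend g (<-wellFounded (weight g))
    where
    descend : ∀ g → Acc _<_ (weight g) → IsRHF s τ g → ∃ λ h → h ≤ᶠ g × IsMinimalRHF s τ h
    descend g (acc smaller) rhf with lowerable? g
    ... | no ¬low = g , ≤ᶠ-refl , ¬lowerable⇒minimal rhf ¬low
    ... | yes (x , a , a<gx , rhf′) =
      let g′≤g = [≔]-≤ᶠ (<ᵛ⇒≤ᵛ a<gx)
          g′x<gx = subst (_<ᵛ g x) (sym (updateAt-updates x g)) a<gx
          h , h≤g′ , min = descend (g [ x ≔ a ]) (smaller (weight-mono-< g′≤g x g′x<gx)) rhf′
      in h , ≤ᶠ-trans h≤g′ g′≤g , min

  minimal⇒lowering-unhits : ∀ {g x a} → IsMinimalRHF s τ g → a <ᵛ g x → ∃ λ i → ¬ Hits (g [ x ≔ a ]) i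
  minimal⇒lowering-unhits {g} {x} {a} (_ , minimal) a<gx =
    ¬∀⟶∃¬ m _ (hits? (g [ x ≔ a ])) λ rhf′ →
      <ᵛ⇒≢ a<gx (trans (sym (updateAt-updates x g)) (minimal _ ([≔]-≤ᶠ (<ᵛ⇒≤ᵛ a<gx)) rhf′ x))

  module _ {g : Fin n → Val} {x a i} (¬hits : ¬ Hits (g [ x ≔ a ]) i) where

    unhit-v2 : ∀ {y} → y ∈ s i → g y ≡ v2 → y ≡ x
    unhit-v2 {y} y∈ gy≡2 = decidable-stable (y ≟ x) λ y≢x →
      ¬hits (inj₁ (y , y∈ , trans (updateAt-minimal y x g y≢x) gy≡2))

    unhit-v1 : ∀ {y} → τ y ≡ i → g y ≡ v1 → y ≡ x
    unhit-v1 {y} τy≡i gy≡1 = decidable-stable (y ≟ x) λ y≢x →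
      ¬hits (inj₂ (y , τy≡i , trans (updateAt-minimal y x g y≢x) gy≡1))

  record PrivateEdge (g : Fin n → Val) (x : Fin n) : Set where
    field
      edge   : Fin m
      ∈edge  : x ∈ s edge
      τ≢edge : τ x ≢ edge
      unique : ∀ y → y ∈ s edge → g y ≡ v2 → y ≡ x

  unhit-after-lowering-v2 : ∀ {g x i} → IsRHF s τ g → g x ≡ v2 → ¬ Hits (g [ x ≔ v1 ]) i → PrivateEdge g x
  unhit-after-lowering-v2 {g} {x} {i} rhf gx≡2 ¬hits = record
    { edge = i ; ∈edge = x∈sᵢ ; τ≢edge = τx≢i ; unique = λ _ → unhit-v2 ¬hits }
    where
    x∈sᵢ : x ∈ s i
    x∈sᵢ with rhf i
    ... | inj₁ (y , y∈ , gy≡2) = subst (_∈ s i) (unhit-v2 ¬hits y∈ gy≡2) y∈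
    ... | inj₂ (y , τy≡i , gy≡1) with unhit-v1 ¬hits τy≡i gy≡1
    ...   | refl = ⊥-elim (v1≢v2 (trans (sym gy≡1) gx≡2))
    τx≢i : τ x ≢ i
    τx≢i τx≡i = ¬hits (inj₂ (x , τx≡i , updateAt-updates x g))

  minimal-v2-private : ∀ {g x} → IsMinimalRHF s τ g → g x ≡ v2 → PrivateEdge g x
  minimal-v2-private min@(rhf , _) gx≡2 =
    let _ , ¬hits = minimal⇒lowering-unhits min (subst (v1 <ᵛ_) (sym gx≡2) 1<2)
    in unhit-after-lowering-v2 rhf gx≡2 ¬hits

  unhit-after-lowering-v1 : ∀ {g x i} → IsRHF s τ g → g x ≡ v1 → ¬ Hits (g [ x ≔ v0 ]) i →
    ∀ y → y ∈ s (τ x) → g y ≢ v2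
  unhit-after-lowering-v1 {g} {x} {i} rhf gx≡1 ¬hits y y∈ gy≡2 with rhf i
  ... | inj₁ (z , z∈ , gz≡2) with unhit-v2 ¬hits z∈ gz≡2
  ...   | refl = v1≢v2 (trans (sym gx≡1) gz≡2)
  unhit-after-lowering-v1 {g} {x} {i} rhf gx≡1 ¬hits y y∈ gy≡2 | inj₂ (z , τz≡i , gz≡1)
    with unhit-v1 ¬hits τz≡i gz≡1
  ...   | refl with unhit-v2 ¬hits (subst (λ j → y ∈ s j) τz≡i y∈) gy≡2
  ...     | refl = v1≢v2 (trans (sym gx≡1) gy≡2)

  minimal-v1-isolated : ∀ {g x} → IsMinimalRHF s τ g → g x ≡ v1 → ∀ y → y ∈ s (τ x) → g y ≢ v2
  minimal-v1-isolated min@(rhf , _) gx≡1 =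
    let _ , ¬hits = minimal⇒lowering-unhits min (subst (v0 <ᵛ_) (sym gx≡1) 0<1)
    in unhit-after-lowering-v1 rhf gx≡1 ¬hits

module _ {n m : ℕ} (s : Fin m → Subset n) (τ : Fin n → Fin m) (f : Fin n → Val) where

  CoveredBy : (R₂ : Subset n) → ((x : Fin n) → x ∈ R₂ → Fin m) → Fin n → Set
  CoveredBy R₂ ρ y = (∃ λ x → f x ≡ v1 × x ∉ R₂ × y ∈ s (τ x)) ⊎ (∃ λ x → Σ (x ∈ R₂) λ p → y ∈ s (ρ x p))

  Certificate : Set
  Certificate = Σ (Subset n) λ R₂ → Σ ((x : Fin n) → x ∈ R₂ → Fin m) λ ρ →
      (∀ x → f x ≡ v2 → x ∈ R₂)
    × (∀ x → x ∈ R₂ → f x ≡ v1 ⊎ f x ≡ v2)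
    × (∀ x (p : x ∈ R₂) → ρ x p ≢ τ x)
    × (∀ x (p : x ∈ R₂) → s (ρ x p) ∩ R₂ ≡ ⁅ x ⁆)
    × (∀ x → f x ≡ v1 → x ∉ R₂ → Empty (s (τ x) ∩ R₂))
    × (∀ i → (∀ x → τ x ≢ i) → (∀ y → y ∈ s i → CoveredBy R₂ ρ y) → Nonempty (s i ∩ R₂))

module Forward {n m : ℕ} (s : Fin m → Subset n) (τ : Fin n → Fin m) (corr : IsCorrespondence s τ)
               (f : Fin n → Val) {g : Fin n → Val} (min : IsMinimalRHF s τ g) (f≤g : f ≤ᶠ g) where

  open RomanHitting s τ corr

  R₂ : Subset n
  R₂ = subset λ x → (g x ≟ᵛ v2) ×-dec ((f x ≟ᵛ v1) ⊎-dec (f x ≟ᵛ v2))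

  ∈R₂⇒g≡v2 : ∀ {x} → x ∈ R₂ → g x ≡ v2
  ∈R₂⇒g≡v2 = proj₁ ∘ ∈-subset⁻ _

  private-edge : ∀ {x} → x ∈ R₂ → PrivateEdge g x
  private-edge p = minimal-v2-private min (∈R₂⇒g≡v2 p)

  open PrivateEdge

  ρ : (x : Fin n) → x ∈ R₂ → Fin m
  ρ x p = edge (private-edge p)

  ∉R₂⇒g≡v1 : ∀ {x} → f x ≡ v1 → x ∉ R₂ → g x ≡ v1
  ∉R₂⇒g≡v1 {x} fx≡1 x∉ with ≡v1-≤ᵛ fx≡1 (f≤g x)
  ... | inj₁ gx≡1 = gx≡1
  ... | inj₂ gx≡2 = ⊥-elim (x∉ (∈-subset⁺ _ (gx≡2 , inj₁ fx≡1)))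

  ρ-private : ∀ x (p : x ∈ R₂) → s (ρ x p) ∩ R₂ ≡ ⁅ x ⁆
  ρ-private x p = ⊆-antisym
    (λ {y} y∈ → let y∈ρ , y∈R₂ = x∈p∩q⁻ _ R₂ y∈ in
      subst (λ z → y ∈ ⁅ z ⁆) (unique (private-edge p) y y∈ρ (∈R₂⇒g≡v2 y∈R₂)) (x∈⁅x⁆ y))
    (λ {y} y∈ → subst (_∈ s (ρ x p) ∩ R₂) (sym (x∈⁅y⁆⇒x≡y x y∈)) (x∈p∩q⁺ (∈edge (private-edge p) , p)))

  τ-avoids-R₂ : ∀ x → f x ≡ v1 → x ∉ R₂ → Empty (s (τ x) ∩ R₂)
  τ-avoids-R₂ x fx≡1 x∉ (y , y∈) = let y∈τ , y∈R₂ = x∈p∩q⁻ _ R₂ y∈ in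
    minimal-v1-isolated min (∉R₂⇒g≡v1 fx≡1 x∉) y y∈τ (∈R₂⇒g≡v2 y∈R₂)

  covered-meets-R₂ : ∀ i → (∀ x → τ x ≢ i) → (∀ y → y ∈ s i → CoveredBy s τ f R₂ ρ y) → Nonempty (s i ∩ R₂)
  covered-meets-R₂ i ¬τ covered with proj₁ min i
  ... | inj₂ (z , τz≡i , _) = ⊥-elim (¬τ z τz≡i)
  ... | inj₁ (y , y∈ , gy≡2) = y , x∈p∩q⁺ (y∈ , y∈R₂ (covered y y∈))
    where
    y∈R₂ : CoveredBy s τ f R₂ ρ y → y ∈ R₂
    y∈R₂ (inj₁ (x , fx≡1 , x∉ , y∈τ)) = ⊥-elim (minimal-v1-isolated min (∉R₂⇒g≡v1 fx≡1 x∉) y y∈τ gy≡2)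
    y∈R₂ (inj₂ (x , p , y∈ρ)) = subst (_∈ R₂) (sym (unique (private-edge p) y y∈ρ gy≡2)) p

  certificate : Certificate s τ f
  certificate =
      R₂ , ρ
    , (λ x fx≡2 → ∈-subset⁺ _ (≡v2-≤ᵛ fx≡2 (f≤g x) , inj₂ fx≡2))
    , (λ x p → proj₂ (∈-subset⁻ _ p))
    , (λ x p ρ≡τ → τ≢edge (private-edge p) (sym ρ≡τ))
    , ρ-private
    , τ-avoids-R₂
    , covered-meets-R₂

module Backward {n m : ℕ} (s : Fin m → Subset n) (τ : Fin n → Fin m) (corr : IsCorrespondence s τ)
  (f : Fin n → Val) (τ-injective-on-1 : ∀ x y → x ≢ y → f x ≡ v1 → f y ≡ v1 → τ x ≢ τ y)
  (R₂ : Subset n) (ρ : (x : Fin n) → x ∈ R₂ → Fin m)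
  (f≡v2⇒∈R₂ : ∀ x → f x ≡ v2 → x ∈ R₂)
  (ρ≢τ : ∀ x (p : x ∈ R₂) → ρ x p ≢ τ x)
  (ρ-private : ∀ x (p : x ∈ R₂) → s (ρ x p) ∩ R₂ ≡ ⁅ x ⁆)
  (τ-avoids-R₂ : ∀ x → f x ≡ v1 → x ∉ R₂ → Empty (s (τ x) ∩ R₂))
  (covered-meets-R₂ : ∀ i → (∀ x → τ x ≢ i) → (∀ y → y ∈ s i → CoveredBy s τ f R₂ ρ y) → Nonempty (s i ∩ R₂))
  where

  open RomanHitting s τ corr

  Covered : Fin n → Set
  Covered = CoveredBy s τ f R₂ ρ

  Served : Fin n → Set
  Served x = Nonempty (s (τ x) ∩ R₂) ⊎ ∃ λ a → f a ≡ v1 × a ∉ R₂ × τ a ≡ τ x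

  covered? : ∀ y → Dec (Covered y)
  covered? y = any? (λ x → (f x ≟ᵛ v1) ×-dec ¬? (x ∈? R₂) ×-dec (y ∈? s (τ x))) ⊎-dec any? on-private-edge?
    where
    on-private-edge? : ∀ x → Dec (Σ (x ∈ R₂) λ p → y ∈ s (ρ x p))
    on-private-edge? x with x ∈? R₂
    ... | no x∉ = no (x∉ ∘ proj₁)
    ... | yes p = map′ (p ,_) (λ (q , y∈) → subst (λ p → y ∈ s (ρ x p)) ([]=-irrelevant q p) y∈) (y ∈? s (ρ x p))

  served? : ∀ x → Dec (Served x)
  served? x = nonempty? (s (τ x) ∩ R₂) ⊎-dec any? (λ a → (f a ≟ᵛ v1) ×-dec ¬? (a ∈? R₂) ×-dec (τ a ≟ τ x))

  data Kind (x : Fin n) : Set where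
    in-R₂     : x ∈ R₂ → Kind x
    one       : x ∉ R₂ → f x ≡ v1 → Kind x
    uncovered : x ∉ R₂ → f x ≢ v1 → ¬ Covered x → Kind x
    served    : x ∉ R₂ → f x ≢ v1 → Covered x → Served x → Kind x
    unserved  : x ∉ R₂ → f x ≢ v1 → Covered x → ¬ Served x → Kind x

  kind : ∀ x → Kind x
  kind x with x ∈? R₂ | f x ≟ᵛ v1 | covered? x | served? x
  ... | yes p  | _       | _       | _       = in-R₂ p
  ... | no x∉ | yes fx≡1 | _       | _       = one x∉ fx≡1
  ... | no x∉ | no fx≢1  | no ¬cov | _       = uncovered x∉ fx≢1 ¬cov
  ... | no x∉ | no fx≢1  | yes cov | yes srv = served x∉ fx≢1 cov srv
  ... | no x∉ | no fx≢1  | yes cov | no ¬srv = unserved x∉ fx≢1 cov ¬srv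

  -- Served points get 0: below g₀, a private edge ρ x or an edge τ x with x ∈ f⁻¹(1) ∖ R₂ can
  -- then only be hit through x itself.
  value : ∀ {x} → Kind x → Val
  value (in-R₂ _)           = v2
  value (one _ _)           = v1
  value (uncovered _ _ _)   = v2
  value (served _ _ _ _)    = v0
  value (unserved _ _ _ _)  = v1

  g₀ : Fin n → Val
  g₀ x = value (kind x)

  self-covered : ∀ {x} → f x ≡ v1 → x ∉ R₂ → Covered x
  self-covered {x} fx≡1 x∉ = inj₁ (x , fx≡1 , x∉ , corr x)

  g₀-R₂ : ∀ {x} → x ∈ R₂ → g₀ x ≡ v2
  g₀-R₂ {x} p with kind x
  ... | in-R₂ _            = refl
  ... | one x∉ _           = ⊥-elim (x∉ p)
  ... | uncovered x∉ _ _   = refl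
  ... | served x∉ _ _ _    = ⊥-elim (x∉ p)
  ... | unserved x∉ _ _ _  = ⊥-elim (x∉ p)

  g₀-one : ∀ {x} → f x ≡ v1 → x ∉ R₂ → g₀ x ≡ v1
  g₀-one {x} fx≡1 x∉ with kind x
  ... | in-R₂ p               = ⊥-elim (x∉ p)
  ... | one _ _               = refl
  ... | uncovered _ _ ¬cov    = ⊥-elim (¬cov (self-covered fx≡1 x∉))
  ... | served _ fx≢1 _ _     = ⊥-elim (fx≢1 fx≡1)
  ... | unserved _ _ _ ¬srv   = ⊥-elim (¬srv (inj₂ (x , fx≡1 , x∉ , refl)))

  g₀-uncovered : ∀ {x} → ¬ Covered x → g₀ x ≡ v2
  g₀-uncovered {x} ¬cov with kind x
  ... | in-R₂ _              = refl
  ... | one x∉ fx≡1          = ⊥-elim (¬cov (self-covered fx≡1 x∉))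
  ... | uncovered _ _ _      = refl
  ... | served _ _ cov _     = ⊥-elim (¬cov cov)
  ... | unserved _ _ cov _   = ⊥-elim (¬cov cov)

  g₀-v2-covered : ∀ {x} → g₀ x ≡ v2 → Covered x → x ∈ R₂
  g₀-v2-covered {x} g₀x≡2 cov with kind x
  ... | in-R₂ p              = p
  ... | uncovered _ _ ¬cov   = ⊥-elim (¬cov cov)

  g₀-v1-unserved : ∀ {x} → g₀ x ≡ v1 →
    Empty (s (τ x) ∩ R₂) × (∀ a → f a ≡ v1 → a ∉ R₂ → τ a ≡ τ x → a ≡ x)
  g₀-v1-unserved {x} g₀x≡1 with kind x
  ... | one x∉ fx≡1 = τ-avoids-R₂ x fx≡1 x∉ , λ a fa≡1 _ τa≡τx →
    decidable-stable (a ≟ x) λ a≢x → τ-injective-on-1 a x a≢x fa≡1 fx≡1 τa≡τx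
  ... | unserved _ _ _ ¬srv = ¬srv ∘ inj₁ , λ a fa≡1 a∉ τa≡τx → ⊥-elim (¬srv (inj₂ (a , fa≡1 , a∉ , τa≡τx)))

  hits-via-R₂ : ∀ {i} → Nonempty (s i ∩ R₂) → Hits g₀ i
  hits-via-R₂ {i} (y , y∈) = let y∈sᵢ , y∈R₂ = x∈p∩q⁻ (s i) R₂ y∈ in inj₁ (y , y∈sᵢ , g₀-R₂ y∈R₂)

  hits-τ-edge : ∀ z → Hits g₀ (τ z)
  hits-τ-edge z with kind z in kz
  ... | in-R₂ p                  = inj₁ (z , corr z , g₀-R₂ p)
  ... | one z∉ fz≡1              = inj₂ (z , refl , g₀-one fz≡1 z∉)
  ... | uncovered _ _ ¬cov       = inj₁ (z , corr z , g₀-uncovered ¬cov)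
  ... | served _ _ _ (inj₁ ne)   = hits-via-R₂ ne
  ... | served _ _ _ (inj₂ (a , fa≡1 , a∉ , τa≡τz)) = inj₂ (a , τa≡τz , g₀-one fa≡1 a∉)
  ... | unserved _ _ _ _         = inj₂ (z , refl , cong value kz)

  g₀-rhf : IsRHF s τ g₀
  g₀-rhf i with any? (λ z → τ z ≟ i) | any? (λ y → (y ∈? s i) ×-dec ¬? (covered? y))
  ... | yes (z , τz≡i) | _                    = subst (Hits g₀) τz≡i (hits-τ-edge z)
  ... | no _           | yes (y , y∈ , ¬cov) = inj₁ (y , y∈ , g₀-uncovered ¬cov)
  ... | no ¬τ          | no ¬uncovered        = hits-via-R₂ (covered-meets-R₂ i (λ z τz≡i → ¬τ (z , τz≡i))
    λ y y∈ → decidable-stable (covered? y) λ ¬cov → ¬uncovered (y , y∈ , ¬cov))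

  private-edge-v2 : ∀ {x y} (p : x ∈ R₂) → y ∈ s (ρ x p) → g₀ y ≡ v2 → y ≡ x
  private-edge-v2 {x} {y} p y∈ g₀y≡2 =
    x∈⁅y⁆⇒x≡y x (subst (y ∈_) (ρ-private x p) (x∈p∩q⁺ (y∈ , g₀-v2-covered g₀y≡2 (inj₂ (x , p , y∈)))))

  τ-edge-no-v2 : ∀ {x y} → f x ≡ v1 → x ∉ R₂ → y ∈ s (τ x) → g₀ y ≢ v2
  τ-edge-no-v2 {x} {y} fx≡1 x∉ y∈ g₀y≡2 =
    τ-avoids-R₂ x fx≡1 x∉ (y , x∈p∩q⁺ (y∈ , g₀-v2-covered g₀y≡2 (inj₁ (x , fx≡1 , x∉ , y∈))))

  module _ {h : Fin n → Val} (h≤g₀ : h ≤ᶠ g₀) (rhfₕ : IsRHF s τ h) where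

    below-g₀-R₂ : ∀ {x} → x ∈ R₂ → h x ≡ v2
    below-g₀-R₂ {x} p with rhfₕ (ρ x p)
    ... | inj₁ (y , y∈ , hy≡2) = subst (λ z → h z ≡ v2) (private-edge-v2 p y∈ (≡v2-≤ᵛ hy≡2 (h≤g₀ y))) hy≡2
    ... | inj₂ (z , τz≡ρ , hz≡1) with ≡v1-≤ᵛ hz≡1 (h≤g₀ z)
    ...   | inj₁ g₀z≡1 = ⊥-elim (proj₁ (g₀-v1-unserved g₀z≡1)
            (x , subst (λ i → x ∈ s i ∩ R₂) (sym τz≡ρ) (subst (x ∈_) (sym (ρ-private x p)) (x∈⁅x⁆ x))))
    ...   | inj₂ g₀z≡2 with private-edge-v2 p (∈-τ τz≡ρ) g₀z≡2
    ...     | refl = ⊥-elim (ρ≢τ z p (sym τz≡ρ))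

    below-g₀-one : ∀ {x} → f x ≡ v1 → x ∉ R₂ → v1 ≤ᵛ h x
    below-g₀-one {x} fx≡1 x∉ with rhfₕ (τ x)
    ... | inj₁ (y , y∈ , hy≡2) = ⊥-elim (τ-edge-no-v2 fx≡1 x∉ y∈ (≡v2-≤ᵛ hy≡2 (h≤g₀ y)))
    ... | inj₂ (z , τz≡τx , hz≡1) with ≡v1-≤ᵛ hz≡1 (h≤g₀ z)
    ...   | inj₂ g₀z≡2 = ⊥-elim (τ-edge-no-v2 fx≡1 x∉ (∈-τ τz≡τx) g₀z≡2)
    ...   | inj₁ g₀z≡1 with proj₂ (g₀-v1-unserved g₀z≡1) x fx≡1 x∉ (sym τz≡τx)
    ...     | refl = subst (v1 ≤ᵛ_) (sym hz≡1) 1≤1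

    below-g₀-dominates : f ≤ᶠ h
    below-g₀-dominates x with x ∈? R₂
    ... | yes p = subst (f x ≤ᵛ_) (sym (below-g₀-R₂ p)) (≤ᵛv2 (f x))
    ... | no x∉ with f x in fx
    ...   | v0 = v0≤ᵛ (h x)
    ...   | v1 = below-g₀-one fx x∉
    ...   | v2 = ⊥-elim (x∉ (f≡v2⇒∈R₂ x fx))

  minimal-extension : ∃ λ g → IsMinimalRHF s τ g × f ≤ᶠ g
  minimal-extension = let h , h≤g₀ , min = minimal-below g₀ g₀-rhf in
    h , min , below-g₀-dominates h≤g₀ (proj₁ min)

theorem9 : {n m : ℕ} (s : Fin m → Subset n) (τ : Fin n → Fin m) →
    IsCorrespondence s τ →
    (f : Fin n → Val) →
    (∀ x y → x ≢ y → f x ≡ v1 → f y ≡ v1 → τ x ≢ τ y) →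
    (∃ λ g → IsMinimalRHF s τ g × f ≤ᶠ g)
    ⇔
    (Σ (Subset n) λ R₂ → Σ ((x : Fin n) → x ∈ R₂ → Fin m) λ ρ →
        (∀ x → f x ≡ v2 → x ∈ R₂)
      × (∀ x → x ∈ R₂ → f x ≡ v1 ⊎ f x ≡ v2)
      × (∀ x (p : x ∈ R₂) → ρ x p ≢ τ x)
      × (∀ x (p : x ∈ R₂) → s (ρ x p) ∩ R₂ ≡ ⁅ x ⁆)
      × (∀ x → f x ≡ v1 → x ∉ R₂ → Empty (s (τ x) ∩ R₂))
      × (∀ i → (∀ x → τ x ≢ i) →
           (∀ y → y ∈ s i →
                (∃ λ x → f x ≡ v1 × x ∉ R₂ × y ∈ s (τ x))
              ⊎ (∃ λ x → Σ (x ∈ R₂) λ p → y ∈ s (ρ x p))) →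
           Nonempty (s i ∩ R₂)))
theorem9 s τ corr f τ-injective-on-1 = mk⇔
  (λ (_ , min , f≤g) → Forward.certificate s τ corr f min f≤g)
  (λ (R₂ , ρ , c₁ , _ , c₃ , c₄ , c₅ , c₆) →
    Backward.minimal-extension s τ corr f τ-injective-on-1 R₂ ρ c₁ c₃ c₄ c₅ c₆)
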